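{- For every closed term $t$ and variable $k\notin\mathrm{fv}(t)$: $\mathcal{S}k.(k\,t)\approx_{env}^p t$, i.e., for every closed pure context $E$, $(\emptyset,\emptyset,\langle E[\mathcal{S}k.(k\,t)]\rangle)\approx_{env}^p(\emptyset,\emptyset,\langle E[t]\rangle)$.
   Context: Calculus $\lambda_S$: terms $t ::= v \mid t\,t \mid \mathcal{S}k.t \mid \langle t\rangle$, values $v ::= x \mid \lambda x.t$; pure contexts $E ::= \square \mid v\,E \mid E\,t$; evaluation contexts $F ::= \square \mid v\,F \mid F\,t \mid \langle F\rangle$. Reduction: $F[(\lambda x.t)\,v] \to F[t\{v/x\}]$; $F[\langle E[\mathcal{S}k.t]\rangle] \to F[\langle t\{\lambda x.\langle E[x]\rangle/k\}\rangle]$ ($x\notin\mathrm{fv}(E)$); $F[\langle v\rangle]\to F[v]$. Multi-hole contexts: $\mathbb{C} ::= \mathbb{V} \mid \mathbb{C}\,\mathbb{C} \mid \langle\mathbb{C}\rangle \mid \mathcal{S}k.\mathbb{C} \mid \blacksquare_j[\mathbb{C}]$; $\mathbb{V} ::= x \mid \lambda x.\mathbb{C} \mid \square_i$; $\mathbb{F} ::= \square \mid \mathbb{F}\,\mathbb{C} \mid \mathbb{V}\,\mathbb{F} \mid \langle\mathbb{F}\rangle \mid \blacksquare_j[\mathbb{F}]$. For a sequence $\Gamma$ of closed values and $\Phi$ of closed evaluation contexts, $\mathbb{C}[\Phi;\Gamma]$ replaces $\square_i$ by $\Gamma_i$ and $\blacksquare_j[\cdot]$ by plugging into $\Phi_j$;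 $\mathbb{F}[t;\Phi;\Gamma]$ additionally fills $\square$ with $t$; $\mathbb{F}[\Phi;\Gamma]$ leaves $\square$ open. Only closed multi-hole contexts are used; an evaluation context is delimited if of the form $\langle F'\rangle$. Pure terms $p ::= v\mid\langle t\rangle$. States: pure states $(\Phi,\Gamma,p)$ and environment states $(\Phi,\Gamma)$. LTS: if $p\to p'$ then $(\Phi,\Gamma,p)\xrightarrow{\tau}(\Phi,\Gamma,p')$; if $\Gamma_i=\lambda x.t$ and $\mathbb{F}[\Phi;\Gamma]$ is delimited then $(\Phi,\Gamma)\xrightarrow{\lambda,i,\mathbb{V},\mathbb{F}}(\Phi,\Gamma,\mathbb{F}[t\{\mathbb{V}[\Phi;\Gamma]/x\};\Phi;\Gamma])$; $(\Phi,\Gamma,v)\xrightarrow{\downarrow}(\Phi,(\Gamma,v))$; if $\mathbb{F}[\Phi;\Gamma]$ is delimited then $(\Phi,\Gamma)\xrightarrow{\square,j,\mathbb{V},\mathbb{F}}(\Phi,\Gamma,\mathbb{F}[\Phi_j[\mathbb{V}[\Phi;\Gamma]];\Phi;\Gamma])$; if $\Phi_j$ is pure then $(\Phi,\Gamma)\xrightarrow{pure,j}(\Phi,\Gamma)$; if $\Phi_j=F[\langle E\rangle]$ with $E$ pure then $(\Phi,\Gamma)\xrightarrow{split,j}((\Phi,F[\langle\square\rangle],\langle E\rangle),\Gamma)$. $\overset{\tau}{\Rightarrow}$ is the reflexive-transitive closure of $\xrightarrow{\tau}$, $\overset{\alpha}{\Rightarrow}=\overset{\tau}{\Rightarrow}\xrightarrow{\alpha}\overset{\tau}{\Rightarrow}$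 for $\alpha\ne\tau$. A pure environmental bisimulation is a relation $R$ on states such that $s\,R\,s'$ and $s\xrightarrow{\alpha}s_1$ imply $s'\overset{\alpha}{\Rightarrow}s_1'$ with $s_1\,R\,s_1'$ for some $s_1'$, and symmetrically; $\approx_{env}^p$ is the largest one. For arbitrary closed terms, $t_0\approx_{env}^p t_1$ iff for every closed pure $E$, $(\emptyset,\emptyset,\langle E[t_0]\rangle)\approx_{env}^p(\emptyset,\emptyset,\langle E[t_1]\rangle)$. -}

module Defs where

open import Data.Nat using (ℕ; zero; suc)
open import Data.Fin using (Fin; zero; suc)
open import Data.List using (List; []; _∷_; _∷ʳ_)
open import Data.Maybe using (Maybe; just; nothing; _>>=_)
open import Data.Product using (Σ; ∃; _×_; _,_)
open import Relation.Binary.PropositionalEquality using (_≡_)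
open import Relation.Binary.Construct.Closure.ReflexiveTransitive using (Star)

-- Syntax of λS (well-scoped de Bruijn terms; n = number of free vars)

mutual
  data Val (n : ℕ) : Set where
    var : Fin n → Val n
    lam : Term (suc n) → Val n

  data Term (n : ℕ) : Set where
    val : Val n → Term n
    app : Term n → Term n → Term n
    sft : Term (suc n) → Term n     -- Sk.t  (k is de Bruijn index 0)
    rst : Term n → Term n

ext : ∀ {n m} → (Fin n → Fin m) → Fin (suc n) → Fin (suc m)
ext ρ zero    = zero
ext ρ (suc i) = suc (ρ i)

mutual
  renV : ∀ {n m} → (Fin n → Fin m) → Val n → Val m
  renV ρ (var x) = var (ρ x)
  renV ρ (lam t) = lam (ren (ext ρ) t)

  ren : ∀ {n m} → (Fin n → Fin m) → Term n → Term m
  ren ρ (val v)   = val (renV ρ v)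
  ren ρ (app t u) = app (ren ρ t) (ren ρ u)
  ren ρ (sft t)   = sft (ren (ext ρ) t)
  ren ρ (rst t)   = rst (ren ρ t)

exts : ∀ {n m} → (Fin n → Val m) → Fin (suc n) → Val (suc m)
exts σ zero    = var zero
exts σ (suc i) = renV suc (σ i)

mutual
  subV : ∀ {n m} → (Fin n → Val m) → Val n → Val m
  subV σ (var x) = σ x
  subV σ (lam t) = lam (sub (exts σ) t)

  sub : ∀ {n m} → (Fin n → Val m) → Term n → Term m
  sub σ (val v)   = val (subV σ v)
  sub σ (app t u) = app (sub σ t) (sub σ u)
  sub σ (sft t)   = sft (sub (exts σ) t)
  sub σ (rst t)   = rst (sub σ t)

single : ∀ {n} → Val n → Fin (suc n) → Val n
single v zero    = v
single v (suc i) = var i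

_[_] : ∀ {n} → Term (suc n) → Val n → Term n
t [ v ] = sub (single v) t

fromClosed : ∀ {n} → Fin 0 → Fin n
fromClosed ()

data ECtx (n : ℕ) : Set where
  hole : ECtx n
  appL : ECtx n → Term n → ECtx n
  appR : Val n → ECtx n → ECtx n
  rstC : ECtx n → ECtx n

data PCtx (n : ℕ) : Set where
  hole : PCtx n
  appL : PCtx n → Term n → PCtx n
  appR : Val n → PCtx n → PCtx n

plugE : ∀ {n} → ECtx n → Term n → Term n
plugE hole       t = t
plugE (appL F u) t = app (plugE F t) u
plugE (appR v F) t = app (val v) (plugE F t)
plugE (rstC F)   t = rst (plugE F t)

plugP : ∀ {n} → PCtx n → Term n → Term n
plugP hole       t = t
plugP (appL E u) t = app (plugP E t) u
plugP (appR v E) t = app (val v) (plugP E t)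

embP : ∀ {n} → PCtx n → ECtx n
embP hole       = hole
embP (appL E u) = appL (embP E) u
embP (appR v E) = appR v (embP E)

_∘E_ : ∀ {n} → ECtx n → ECtx n → ECtx n
hole     ∘E G = G
appL F u ∘E G = appL (F ∘E G) u
appR v F ∘E G = appR v (F ∘E G)
rstC F   ∘E G = rstC (F ∘E G)

renE : ∀ {n m} → (Fin n → Fin m) → ECtx n → ECtx m
renE ρ hole       = hole
renE ρ (appL F u) = appL (renE ρ F) (ren ρ u)
renE ρ (appR v F) = appR (renV ρ v) (renE ρ F)
renE ρ (rstC F)   = rstC (renE ρ F)

renP : ∀ {n m} → (Fin n → Fin m) → PCtx n → PCtx m
renP ρ hole       = hole
renP ρ (appL E u) = appL (renP ρ E) (ren ρ u)
renP ρ (appR v E) = appR (renV ρ v) (renP ρ E)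

IsPureCtx : ∀ {n} → ECtx n → Set
IsPureCtx {n} F = Σ (PCtx n) λ E → embP E ≡ F

data _⟶_ : Term 0 → Term 0 → Set where
  β-red     : (F : ECtx 0) (t : Term 1) (v : Val 0) →
              plugE F (app (val (lam t)) (val v)) ⟶ plugE F (t [ v ])
  shift-red : (F : ECtx 0) (E : PCtx 0) (t : Term 1) →
              plugE F (rst (plugP E (sft t)))
                ⟶ plugE F (rst (t [ lam (rst (plugP (renP suc E) (val (var zero)))) ]))
  reset-red : (F : ECtx 0) (v : Val 0) →
              plugE F (rst (val v)) ⟶ plugE F (val v)

mutual
  -- ℂ ::= 𝕍 | ℂ ℂ | ⟨ℂ⟩ | Sk.ℂ | ■ⱼ[ℂ]
  data MC (n : ℕ) : Set where
    mval : MV n → MC n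
    mapp : MC n → MC n → MC n
    mrst : MC n → MC n
    msft : MC (suc n) → MC n
    mbox : ℕ → MC n → MC n

  -- 𝕍 ::= x | λx.ℂ | □ᵢ
  data MV (n : ℕ) : Set where
    mvar  : Fin n → MV n
    mlam  : MC (suc n) → MV n
    mhole : ℕ → MV n

-- 𝔽 ::= □ | 𝔽 ℂ | 𝕍 𝔽 | ⟨𝔽⟩ | ■ⱼ[𝔽]   (closed)
data MF : Set where
  fhole : MF
  fappL : MF → MC 0 → MF
  fappR : MV 0 → MF → MF
  frst  : MF → MF
  fbox  : ℕ → MF → MF

nth : ∀ {A : Set} → List A → ℕ → Maybe A
nth []       _       = nothing
nth (x ∷ xs) zero    = just x
nth (x ∷ xs) (suc i) = nth xs i

Env = List (ECtx 0)
VEnv = List (Val 0)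

-- ℂ[Φ;Γ]  (nothing if some index is out of range)
mutual
  fillC : ∀ {n} → Env → VEnv → MC n → Maybe (Term n)
  fillC Φ Γ (mval V)   = fillV Φ Γ V >>= λ v → just (val v)
  fillC Φ Γ (mapp C D) = fillC Φ Γ C >>= λ t → fillC Φ Γ D >>= λ u → just (app t u)
  fillC Φ Γ (mrst C)   = fillC Φ Γ C >>= λ t → just (rst t)
  fillC Φ Γ (msft C)   = fillC Φ Γ C >>= λ t → just (sft t)
  fillC Φ Γ (mbox j C) = nth Φ j >>= λ F → fillC Φ Γ C >>= λ t →
                         just (plugE (renE fromClosed F) t)

  fillV : ∀ {n} → Env → VEnv → MV n → Maybe (Val n)
  fillV Φ Γ (mvar x)  = just (var x)
  fillV Φ Γ (mlam C)  = fillC Φ Γ C >>= λ t → just (lam t)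
  fillV Φ Γ (mhole i) = nth Γ i >>= λ v → just (renV fromClosed v)

fillF : Env → VEnv → MF → Maybe (ECtx 0)
fillF Φ Γ fhole       = just hole
fillF Φ Γ (fappL F C) = fillF Φ Γ F >>= λ G → fillC Φ Γ C >>= λ t → just (appL G t)
fillF Φ Γ (fappR V F) = fillV Φ Γ V >>= λ v → fillF Φ Γ F >>= λ G → just (appR v G)
fillF Φ Γ (frst F)    = fillF Φ Γ F >>= λ G → just (rstC G)
fillF Φ Γ (fbox j F)  = nth Φ j >>= λ H → fillF Φ Γ F >>= λ G → just (H ∘E G)

data PureT : Set where
  pval : Val 0 → PureT
  prst : Term 0 → PureT

⌜_⌝ : PureT → Term 0
⌜ pval v ⌝ = val v
⌜ prst t ⌝ = rst t

data State : Set where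
  pst : Env → VEnv → PureT → State
  est : Env → VEnv → State

data Label : Set where
  τ      : Label
  lamL   : ℕ → MV 0 → MF → Label
  retL   : Label
  holeL  : ℕ → MV 0 → MF → Label
  pureL  : ℕ → Label
  splitL : ℕ → Label

-- 𝔽[Φ;Γ] is delimited, i.e. of the form ⟨F'⟩, so 𝔽[t;Φ;Γ] = ⟨F'[t]⟩
data _—[_]→_ : State → Label → State → Set where
  step-τ     : ∀ {Φ Γ p p'} → ⌜ p ⌝ ⟶ ⌜ p' ⌝ →
               pst Φ Γ p —[ τ ]→ pst Φ Γ p'
  step-λ     : ∀ {Φ Γ i V F t w F'} →
               nth Γ i ≡ just (lam t) →
               fillV Φ Γ V ≡ just w →
               fillF Φ Γ F ≡ just (rstC F') →
               est Φ Γ —[ lamL i V F ]→ pst Φ Γ (prst (plugE F' (t [ w ])))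
  step-↓     : ∀ {Φ Γ v} →
               pst Φ Γ (pval v) —[ retL ]→ est Φ (Γ ∷ʳ v)
  step-□     : ∀ {Φ Γ j V F Fj w F'} →
               nth Φ j ≡ just Fj →
               fillV Φ Γ V ≡ just w →
               fillF Φ Γ F ≡ just (rstC F') →
               est Φ Γ —[ holeL j V F ]→ pst Φ Γ (prst (plugE F' (plugE Fj (val w))))
  step-pure  : ∀ {Φ Γ j Fj} →
               nth Φ j ≡ just Fj → IsPureCtx Fj →
               est Φ Γ —[ pureL j ]→ est Φ Γ
  step-split : ∀ {Φ Γ j} (F : ECtx 0) (E : PCtx 0) →
               nth Φ j ≡ just (F ∘E rstC (embP E)) →
               est Φ Γ —[ splitL j ]→ est ((Φ ∷ʳ (F ∘E rstC hole)) ∷ʳ rstC (embP E)) Γ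

_—τ→_ : State → State → Set
s —τ→ s' = s —[ τ ]→ s'

_=τ⇒_ : State → State → Set
_=τ⇒_ = Star _—τ→_

_=[_]⇒_ : State → Label → State → Set
s =[ τ ]⇒ s' = s =τ⇒ s'
s =[ α ]⇒ s' = ∃ λ s₁ → ∃ λ s₂ → s =τ⇒ s₁ × s₁ —[ α ]→ s₂ × s₂ =τ⇒ s'

record IsPureEnvBisim (R : State → State → Set) : Set where
  field
    forth : ∀ {s s' α s₁} → R s s' → s —[ α ]→ s₁ →
            ∃ λ s₁' → s' =[ α ]⇒ s₁' × R s₁ s₁'
    back  : ∀ {s s' α s₁'} → R s s' → s' —[ α ]→ s₁' →
            ∃ λ s₁ → s =[ α ]⇒ s₁ × R s₁ s₁'

-- the largest pure environmental bisimulation (union of all of them)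
_≈ᵖ_ : State → State → Set₁
s ≈ᵖ s' = Σ (State → State → Set) λ R → IsPureEnvBisim R × R s s'

_≈ᵖenv_ : Term 0 → Term 0 → Set₁
t₀ ≈ᵖenv t₁ = (E : PCtx 0) → pst [] [] (prst (plugP E t₀)) ≈ᵖ pst [] [] (prst (plugP E t₁))

-- Sk.(k t) with k ∉ fv(t): k is de Bruijn index 0, t weakened
Sk-kt : Term 0 → Term 0
Sk-kt t = sft (app (val (var zero)) (ren suc t))

-- After one shift step ⟨E[Sk.k t]⟩ becomes ⟨(λx.⟨E[x]⟩) t⟩, so it suffices to relate
-- terms by the least congruence (closed under renaming and substitution) containing
--   ⟨(λx.⟨E[x]⟩) b⟩ ~ ⟨E'[b']⟩   (the captured continuation is still waiting for b)
--   ⟨⟨a⟩⟩ ~ ⟨a'⟩                  (the continuation has been applied)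
-- whenever E ~ E', b ~ b', a ~ a'. This relation is a weak bisimulation for reduction,
-- related values fill multi-hole contexts into related terms, and the context
-- environment stays empty, so it lifts to a pure environmental bisimulation.

module Submission where

open import Defs
open import Data.Nat using (ℕ; zero; suc)
open import Data.Fin using (Fin; zero; suc)
open import Data.List using ([]; _∷_)
open import Data.List.Relation.Binary.Pointwise as List using ([]; _∷_; ++⁺)
open import Data.Maybe using (just; nothing; _>>=_)
open import Data.Maybe.Relation.Binary.Pointwise as Maybe using (just; nothing; just-inv)
open import Data.Product using (Σ; ∃; _×_; _,_; -,_)
open import Data.Unit using (⊤; tt)
open import Data.Empty using (⊥; ⊥-elim)
open import Relation.Binary.PropositionalEquality
  using (_≡_; refl; sym; trans; cong; cong₂; subst; subst₂)
open import Relation.Binary.Construct.Closure.ReflexiveTransitive using (Star; ε; _◅_; gmap)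

ext-ren : ∀ {n m k} {ρ : Fin m → Fin k} {ρ' : Fin n → Fin m} {ρ'' : Fin n → Fin k} →
  (∀ x → ρ (ρ' x) ≡ ρ'' x) → ∀ x → ext ρ (ext ρ' x) ≡ ext ρ'' x
ext-ren h zero    = refl
ext-ren h (suc x) = cong suc (h x)

mutual
  renV-ren : ∀ {n m k} {ρ : Fin m → Fin k} {ρ' : Fin n → Fin m} {ρ'' : Fin n → Fin k} →
    (∀ x → ρ (ρ' x) ≡ ρ'' x) → ∀ v → renV ρ (renV ρ' v) ≡ renV ρ'' v
  renV-ren h (var x) = cong var (h x)
  renV-ren h (lam t) = cong lam (ren-ren (ext-ren h) t)

  ren-ren : ∀ {n m k} {ρ : Fin m → Fin k} {ρ' : Fin n → Fin m} {ρ'' : Fin n → Fin k} →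
    (∀ x → ρ (ρ' x) ≡ ρ'' x) → ∀ t → ren ρ (ren ρ' t) ≡ ren ρ'' t
  ren-ren h (val v)   = cong val (renV-ren h v)
  ren-ren h (app t u) = cong₂ app (ren-ren h t) (ren-ren h u)
  ren-ren h (sft t)   = cong sft (ren-ren (ext-ren h) t)
  ren-ren h (rst t)   = cong rst (ren-ren h t)

exts-ext : ∀ {n m k} {σ : Fin m → Val k} {ρ : Fin n → Fin m} {σ' : Fin n → Val k} →
  (∀ x → σ (ρ x) ≡ σ' x) → ∀ x → exts σ (ext ρ x) ≡ exts σ' x
exts-ext h zero    = refl
exts-ext h (suc x) = cong (renV suc) (h x)

mutual
  subV-renV : ∀ {n m k} {σ : Fin m → Val k} {ρ : Fin n → Fin m} {σ' : Fin n → Val k} →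
    (∀ x → σ (ρ x) ≡ σ' x) → ∀ v → subV σ (renV ρ v) ≡ subV σ' v
  subV-renV h (var x) = h x
  subV-renV h (lam t) = cong lam (sub-ren (exts-ext h) t)

  sub-ren : ∀ {n m k} {σ : Fin m → Val k} {ρ : Fin n → Fin m} {σ' : Fin n → Val k} →
    (∀ x → σ (ρ x) ≡ σ' x) → ∀ t → sub σ (ren ρ t) ≡ sub σ' t
  sub-ren h (val v)   = cong val (subV-renV h v)
  sub-ren h (app t u) = cong₂ app (sub-ren h t) (sub-ren h u)
  sub-ren h (sft t)   = cong sft (sub-ren (exts-ext h) t)
  sub-ren h (rst t)   = cong rst (sub-ren h t)

ext-exts : ∀ {n m k} {ρ : Fin m → Fin k} {σ : Fin n → Val m} {σ' : Fin n → Val k} →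
  (∀ x → renV ρ (σ x) ≡ σ' x) → ∀ x → renV (ext ρ) (exts σ x) ≡ exts σ' x
ext-exts h zero = refl
ext-exts {σ = σ} h (suc x) =
  trans (renV-ren (λ _ → refl) (σ x))
        (trans (sym (renV-ren (λ _ → refl) (σ x))) (cong (renV suc) (h x)))

mutual
  renV-subV : ∀ {n m k} {ρ : Fin m → Fin k} {σ : Fin n → Val m} {σ' : Fin n → Val k} →
    (∀ x → renV ρ (σ x) ≡ σ' x) → ∀ v → renV ρ (subV σ v) ≡ subV σ' v
  renV-subV h (var x) = h x
  renV-subV h (lam t) = cong lam (ren-sub (ext-exts h) t)

  ren-sub : ∀ {n m k} {ρ : Fin m → Fin k} {σ : Fin n → Val m} {σ' : Fin n → Val k} →
    (∀ x → renV ρ (σ x) ≡ σ' x) → ∀ t → ren ρ (sub σ t) ≡ sub σ' t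
  ren-sub h (val v)   = cong val (renV-subV h v)
  ren-sub h (app t u) = cong₂ app (ren-sub h t) (ren-sub h u)
  ren-sub h (sft t)   = cong sft (ren-sub (ext-exts h) t)
  ren-sub h (rst t)   = cong rst (ren-sub h t)

exts-id : ∀ {n} {σ : Fin n → Val n} → (∀ x → σ x ≡ var x) → ∀ x → exts σ x ≡ var x
exts-id h zero    = refl
exts-id h (suc x) = cong (renV suc) (h x)

mutual
  subV-id : ∀ {n} {σ : Fin n → Val n} → (∀ x → σ x ≡ var x) → ∀ v → subV σ v ≡ v
  subV-id h (var x) = h x
  subV-id h (lam t) = cong lam (sub-id (exts-id h) t)

  sub-id : ∀ {n} {σ : Fin n → Val n} → (∀ x → σ x ≡ var x) → ∀ t → sub σ t ≡ t
  sub-id h (val v)   = cong val (subV-id h v)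
  sub-id h (app t u) = cong₂ app (sub-id h t) (sub-id h u)
  sub-id h (sft t)   = cong sft (sub-id (exts-id h) t)
  sub-id h (rst t)   = cong rst (sub-id h t)

ren-suc-[] : ∀ {n} (t : Term n) w → ren suc t [ w ] ≡ t
ren-suc-[] t w = trans (sub-ren (λ _ → refl) t) (sub-id (λ _ → refl) t)

subP : ∀ {n m} → (Fin n → Val m) → PCtx n → PCtx m
subP σ hole       = hole
subP σ (appL E u) = appL (subP σ E) (sub σ u)
subP σ (appR v E) = appR (subV σ v) (subP σ E)

_∘P_ : ∀ {n} → PCtx n → PCtx n → PCtx n
hole     ∘P G = G
appL E u ∘P G = appL (E ∘P G) u
appR v E ∘P G = appR v (E ∘P G)

ren-plugP : ∀ {n m} (ρ : Fin n → Fin m) E t → ren ρ (plugP E t) ≡ plugP (renP ρ E) (ren ρ t)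
ren-plugP ρ hole       t = refl
ren-plugP ρ (appL E u) t = cong (λ z → app z (ren ρ u)) (ren-plugP ρ E t)
ren-plugP ρ (appR v E) t = cong (app (val (renV ρ v))) (ren-plugP ρ E t)

sub-plugP : ∀ {n m} (σ : Fin n → Val m) E t → sub σ (plugP E t) ≡ plugP (subP σ E) (sub σ t)
sub-plugP σ hole       t = refl
sub-plugP σ (appL E u) t = cong (λ z → app z (sub σ u)) (sub-plugP σ E t)
sub-plugP σ (appR v E) t = cong (app (val (subV σ v))) (sub-plugP σ E t)

renP-renP : ∀ {n m k} {ρ : Fin m → Fin k} {ρ' : Fin n → Fin m} {ρ'' : Fin n → Fin k} →
  (∀ x → ρ (ρ' x) ≡ ρ'' x) → ∀ E → renP ρ (renP ρ' E) ≡ renP ρ'' E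
renP-renP h hole       = refl
renP-renP h (appL E u) = cong₂ appL (renP-renP h E) (ren-ren h u)
renP-renP h (appR v E) = cong₂ appR (renV-ren h v) (renP-renP h E)

subP-renP : ∀ {n m k} {σ : Fin m → Val k} {ρ : Fin n → Fin m} {σ' : Fin n → Val k} →
  (∀ x → σ (ρ x) ≡ σ' x) → ∀ E → subP σ (renP ρ E) ≡ subP σ' E
subP-renP h hole       = refl
subP-renP h (appL E u) = cong₂ appL (subP-renP h E) (sub-ren h u)
subP-renP h (appR v E) = cong₂ appR (subV-renV h v) (subP-renP h E)

renP-subP : ∀ {n m k} {ρ : Fin m → Fin k} {σ : Fin n → Val m} {σ' : Fin n → Val k} →
  (∀ x → renV ρ (σ x) ≡ σ' x) → ∀ E → renP ρ (subP σ E) ≡ subP σ' E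
renP-subP h hole       = refl
renP-subP h (appL E u) = cong₂ appL (renP-subP h E) (ren-sub h u)
renP-subP h (appR v E) = cong₂ appR (renV-subV h v) (renP-subP h E)

subP-id : ∀ {n} {σ : Fin n → Val n} → (∀ x → σ x ≡ var x) → ∀ E → subP σ E ≡ E
subP-id h hole       = refl
subP-id h (appL E u) = cong₂ appL (subP-id h E) (sub-id h u)
subP-id h (appR v E) = cong₂ appR (subV-id h v) (subP-id h E)

plugE-∘E : ∀ (G F : ECtx 0) t → plugE (G ∘E F) t ≡ plugE G (plugE F t)
plugE-∘E hole       F t = refl
plugE-∘E (appL G u) F t = cong (λ z → app z u) (plugE-∘E G F t)
plugE-∘E (appR v G) F t = cong (app (val v)) (plugE-∘E G F t)
plugE-∘E (rstC G)   F t = cong rst (plugE-∘E G F t)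

cont-body : ∀ {n} → PCtx n → Term (suc n)
cont-body E = rst (plugP (renP suc E) (val (var zero)))

cont : ∀ {n} → PCtx n → Val n
cont E = lam (cont-body E)

renV-cont : ∀ {n m} (ρ : Fin n → Fin m) E → renV ρ (cont E) ≡ cont (renP ρ E)
renV-cont ρ E = cong (λ z → lam (rst z))
  (trans (ren-plugP (ext ρ) (renP suc E) (val (var zero)))
         (cong (λ F → plugP F (val (var zero)))
               (trans (renP-renP (λ _ → refl) E) (sym (renP-renP (λ _ → refl) E)))))

subV-cont : ∀ {n m} (σ : Fin n → Val m) E → subV σ (cont E) ≡ cont (subP σ E)
subV-cont σ E = cong (λ z → lam (rst z))
  (trans (sub-plugP (exts σ) (renP suc E) (val (var zero)))
         (cong (λ F → plugP F (val (var zero)))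
               (trans (subP-renP (λ _ → refl) E) (sym (renP-subP (λ _ → refl) E)))))

cont-body-[] : ∀ {n} (E : PCtx n) w → cont-body E [ w ] ≡ rst (plugP E (val w))
cont-body-[] E w = cong rst (trans (sub-plugP (single w) (renP suc E) (val (var zero)))
  (cong (λ F → plugP F (val w)) (trans (subP-renP (λ _ → refl) E) (subP-id (λ _ → refl) E))))

data ShiftRedex {n : ℕ} : Term n → PCtx n → Term (suc n) → Set where
  sr-hole : ∀ {u} → ShiftRedex (sft u) hole u
  sr-appL : ∀ {a b E u} → ShiftRedex a E u → ShiftRedex (app a b) (appL E b) u
  sr-appR : ∀ {v a E u} → ShiftRedex a E u → ShiftRedex (app (val v) a) (appR v E) u

data Plugs {n : ℕ} : PCtx n → Term n → Term n → Set where
  p-hole : ∀ {b} → Plugs hole b b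
  p-appL : ∀ {E b s u} → Plugs E b s → Plugs (appL E u) b (app s u)
  p-appR : ∀ {E b s v} → Plugs E b s → Plugs (appR v E) b (app (val v) s)

-- Unlike _⟶_, whose redex position is hidden behind plugE, this presentation
-- can be inverted by pattern matching.
infix 4 _↦_
data _↦_ : Term 0 → Term 0 → Set where
  β      : ∀ t v → app (val (lam t)) (val v) ↦ t [ v ]
  shift  : ∀ {a E u} → ShiftRedex a E u → rst a ↦ rst (u [ cont E ])
  reset  : ∀ v → rst (val v) ↦ val v
  ξ-appL : ∀ {a a' b} → a ↦ a' → app a b ↦ app a' b
  ξ-appR : ∀ v {a a'} → a ↦ a' → app (val v) a ↦ app (val v) a'
  ξ-rst  : ∀ {a a'} → a ↦ a' → rst a ↦ rst a'

_↦*_ : Term 0 → Term 0 → Set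
_↦*_ = Star _↦_

shiftRedex-plugP : ∀ {n} (E : PCtx n) t → ShiftRedex (plugP E (sft t)) E t
shiftRedex-plugP hole       t = sr-hole
shiftRedex-plugP (appL E u) t = sr-appL (shiftRedex-plugP E t)
shiftRedex-plugP (appR v E) t = sr-appR (shiftRedex-plugP E t)

shiftRedex⇒plugP : ∀ {n} {a : Term n} {E u} → ShiftRedex a E u → a ≡ plugP E (sft u)
shiftRedex⇒plugP sr-hole              = refl
shiftRedex⇒plugP (sr-appL {b = b} sr) = cong (λ z → app z b) (shiftRedex⇒plugP sr)
shiftRedex⇒plugP (sr-appR {v = v} sr) = cong (app (val v)) (shiftRedex⇒plugP sr)

shiftRedex-unique : ∀ {n} {a : Term n} {E u E' u'} →
  ShiftRedex a E u → ShiftRedex a E' u' → E ≡ E' × u ≡ u'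
shiftRedex-unique sr-hole sr-hole = refl , refl
shiftRedex-unique (sr-appL s) (sr-appL s') with shiftRedex-unique s s'
... | refl , refl = refl , refl
shiftRedex-unique (sr-appL ()) (sr-appR s')
shiftRedex-unique (sr-appR s) (sr-appL ())
shiftRedex-unique (sr-appR s) (sr-appR s') with shiftRedex-unique s s'
... | refl , refl = refl , refl

shiftRedex-irreducible : ∀ {a E u b} → ShiftRedex a E u → a ↦ b → ⊥
shiftRedex-irreducible (sr-appL ())  (β t v)
shiftRedex-irreducible (sr-appL sr)  (ξ-appL d)   = shiftRedex-irreducible sr d
shiftRedex-irreducible (sr-appL ())  (ξ-appR v d)
shiftRedex-irreducible (sr-appR ())  (β t v)
shiftRedex-irreducible (sr-appR sr)  (ξ-appL ())
shiftRedex-irreducible (sr-appR sr)  (ξ-appR v d) = shiftRedex-irreducible sr d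

rst-shiftRedex-↦ : ∀ {a E u s₁} → ShiftRedex a E u → rst a ↦ s₁ → s₁ ≡ rst (u [ cont E ])
rst-shiftRedex-↦ sr (shift sr') with shiftRedex-unique sr sr'
... | refl , refl = refl
rst-shiftRedex-↦ ()  (reset v)
rst-shiftRedex-↦ sr (ξ-rst d) = ⊥-elim (shiftRedex-irreducible sr d)

plugs-plugP : ∀ {n} (E : PCtx n) b → Plugs E b (plugP E b)
plugs-plugP hole       b = p-hole
plugs-plugP (appL E u) b = p-appL (plugs-plugP E b)
plugs-plugP (appR v E) b = p-appR (plugs-plugP E b)

↦-plugE : ∀ (F : ECtx 0) {a b} → a ↦ b → plugE F a ↦ plugE F b
↦-plugE hole       d = d
↦-plugE (appL F u) d = ξ-appL (↦-plugE F d)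
↦-plugE (appR v F) d = ξ-appR v (↦-plugE F d)
↦-plugE (rstC F)   d = ξ-rst (↦-plugE F d)

⟶⇒↦ : ∀ {s s'} → s ⟶ s' → s ↦ s'
⟶⇒↦ (β-red F t v)     = ↦-plugE F (β t v)
⟶⇒↦ (shift-red F E t) = ↦-plugE F (shift (shiftRedex-plugP E t))
⟶⇒↦ (reset-red F v)   = ↦-plugE F (reset v)

⟶-plugE : ∀ (G : ECtx 0) {s s'} → s ⟶ s' → plugE G s ⟶ plugE G s'
⟶-plugE G (β-red F t v)     = subst₂ _⟶_ (plugE-∘E G F _) (plugE-∘E G F _) (β-red (G ∘E F) t v)
⟶-plugE G (shift-red F E t) = subst₂ _⟶_ (plugE-∘E G F _) (plugE-∘E G F _) (shift-red (G ∘E F) E t)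
⟶-plugE G (reset-red F v)   = subst₂ _⟶_ (plugE-∘E G F _) (plugE-∘E G F _) (reset-red (G ∘E F) v)

↦⇒⟶ : ∀ {s s'} → s ↦ s' → s ⟶ s'
↦⇒⟶ (β t v)                         = β-red hole t v
↦⇒⟶ (shift {E = E} {u = u} sr)      =
  subst (λ a → rst a ⟶ _) (sym (shiftRedex⇒plugP sr)) (shift-red hole E u)
↦⇒⟶ (reset v)                       = reset-red hole v
↦⇒⟶ (ξ-appL {b = b} d)              = ⟶-plugE (appL hole b) (↦⇒⟶ d)
↦⇒⟶ (ξ-appR v d)                    = ⟶-plugE (appR v hole) (↦⇒⟶ d)
↦⇒⟶ (ξ-rst d)                       = ⟶-plugE (rstC hole) (↦⇒⟶ d)

infix 4 _~_ _~V_ _~P_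
mutual
  data _~V_ : ∀ {n} → Val n → Val n → Set where
    var~ : ∀ {n} (x : Fin n) → var x ~V var x
    lam~ : ∀ {n} {t t' : Term (suc n)} → t ~ t' → lam t ~V lam t'

  data _~_ : ∀ {n} → Term n → Term n → Set where
    val~  : ∀ {n} {v v' : Val n} → v ~V v' → val v ~ val v'
    app~  : ∀ {n} {a a' b b' : Term n} → a ~ a' → b ~ b' → app a b ~ app a' b'
    sft~  : ∀ {n} {t t' : Term (suc n)} → t ~ t' → sft t ~ sft t'
    rst~  : ∀ {n} {a a' : Term n} → a ~ a' → rst a ~ rst a'
    ~cont : ∀ {n} {E E' : PCtx n} {b b' s'} → E ~P E' → b ~ b' → Plugs E' b' s' →
            rst (app (val (cont E)) b) ~ rst s'
    ~rst² : ∀ {n} {a a' : Term n} → a ~ a' → rst (rst a) ~ rst a'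

  data _~P_ : ∀ {n} → PCtx n → PCtx n → Set where
    hole~ : ∀ {n} → hole {n} ~P hole
    appL~ : ∀ {n} {E E' : PCtx n} {u u'} → E ~P E' → u ~ u' → appL E u ~P appL E' u'
    appR~ : ∀ {n} {E E' : PCtx n} {v v'} → v ~V v' → E ~P E' → appR v E ~P appR v' E'

mutual
  ~V-refl : ∀ {n} (v : Val n) → v ~V v
  ~V-refl (var x) = var~ x
  ~V-refl (lam t) = lam~ (~-refl t)

  ~-refl : ∀ {n} (t : Term n) → t ~ t
  ~-refl (val v)   = val~ (~V-refl v)
  ~-refl (app t u) = app~ (~-refl t) (~-refl u)
  ~-refl (sft t)   = sft~ (~-refl t)
  ~-refl (rst t)   = rst~ (~-refl t)

~P-refl : ∀ {n} (E : PCtx n) → E ~P E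
~P-refl hole       = hole~
~P-refl (appL E u) = appL~ (~P-refl E) (~-refl u)
~P-refl (appR v E) = appR~ (~V-refl v) (~P-refl E)

plugP~ : ∀ {n} {E E' : PCtx n} {b b'} → E ~P E' → b ~ b' → plugP E b ~ plugP E' b'
plugP~ hole~       r = r
plugP~ (appL~ e u) r = app~ (plugP~ e r) u
plugP~ (appR~ v e) r = app~ (val~ v) (plugP~ e r)

plugs~ : ∀ {n} {E E' : PCtx n} {b b' s'} → E ~P E' → b ~ b' → Plugs E' b' s' → plugP E b ~ s'
plugs~ hole~       r p-hole     = r
plugs~ (appL~ e u) r (p-appL p) = app~ (plugs~ e r p) u
plugs~ (appR~ v e) r (p-appR p) = app~ (val~ v) (plugs~ e r p)

plugs-ren : ∀ {n m} (ρ : Fin n → Fin m) {E b s} → Plugs E b s → Plugs (renP ρ E) (ren ρ b) (ren ρ s)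
plugs-ren ρ p-hole     = p-hole
plugs-ren ρ (p-appL p) = p-appL (plugs-ren ρ p)
plugs-ren ρ (p-appR p) = p-appR (plugs-ren ρ p)

plugs-sub : ∀ {n m} (σ : Fin n → Val m) {E b s} → Plugs E b s → Plugs (subP σ E) (sub σ b) (sub σ s)
plugs-sub σ p-hole     = p-hole
plugs-sub σ (p-appL p) = p-appL (plugs-sub σ p)
plugs-sub σ (p-appR p) = p-appR (plugs-sub σ p)

mutual
  renV~ : ∀ {n m} (ρ : Fin n → Fin m) {v v'} → v ~V v' → renV ρ v ~V renV ρ v'
  renV~ ρ (var~ x) = var~ (ρ x)
  renV~ ρ (lam~ r) = lam~ (ren~ (ext ρ) r)

  ren~ : ∀ {n m} (ρ : Fin n → Fin m) {t t'} → t ~ t' → ren ρ t ~ ren ρ t'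
  ren~ ρ (val~ r)   = val~ (renV~ ρ r)
  ren~ ρ (app~ r q) = app~ (ren~ ρ r) (ren~ ρ q)
  ren~ ρ (sft~ r)   = sft~ (ren~ (ext ρ) r)
  ren~ ρ (rst~ r)   = rst~ (ren~ ρ r)
  ren~ ρ (~cont {E = E} {b = b} {s' = s'} e r p) =
    subst (λ z → rst (app (val z) (ren ρ b)) ~ rst (ren ρ s')) (sym (renV-cont ρ E))
      (~cont (renP~ ρ e) (ren~ ρ r) (plugs-ren ρ p))
  ren~ ρ (~rst² r)  = ~rst² (ren~ ρ r)

  renP~ : ∀ {n m} (ρ : Fin n → Fin m) {E E'} → E ~P E' → renP ρ E ~P renP ρ E'
  renP~ ρ hole~       = hole~
  renP~ ρ (appL~ e u) = appL~ (renP~ ρ e) (ren~ ρ u)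
  renP~ ρ (appR~ v e) = appR~ (renV~ ρ v) (renP~ ρ e)

_~σ_ : ∀ {n m} → (Fin n → Val m) → (Fin n → Val m) → Set
σ ~σ σ' = ∀ x → σ x ~V σ' x

exts~ : ∀ {n m} {σ σ' : Fin n → Val m} → σ ~σ σ' → exts σ ~σ exts σ'
exts~ h zero    = var~ zero
exts~ h (suc x) = renV~ suc (h x)

single~ : ∀ {n} {v v' : Val n} → v ~V v' → single v ~σ single v'
single~ r zero    = r
single~ r (suc x) = var~ x

mutual
  subV~ : ∀ {n m} {σ σ' : Fin n → Val m} → σ ~σ σ' → ∀ {v v'} → v ~V v' → subV σ v ~V subV σ' v'
  subV~ h (var~ x) = h x
  subV~ h (lam~ r) = lam~ (sub~ (exts~ h) r)

  sub~ : ∀ {n m} {σ σ' : Fin n → Val m} → σ ~σ σ' → ∀ {t t'} → t ~ t' → sub σ t ~ sub σ' t'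
  sub~ h (val~ r)   = val~ (subV~ h r)
  sub~ h (app~ r q) = app~ (sub~ h r) (sub~ h q)
  sub~ h (sft~ r)   = sft~ (sub~ (exts~ h) r)
  sub~ h (rst~ r)   = rst~ (sub~ h r)
  sub~ {σ = σ} {σ'} h (~cont {E = E} {b = b} {s' = s'} e r p) =
    subst (λ z → rst (app (val z) (sub σ b)) ~ rst (sub σ' s')) (sym (subV-cont σ E))
      (~cont (subP~ h e) (sub~ h r) (plugs-sub σ' p))
  sub~ h (~rst² r)  = ~rst² (sub~ h r)

  subP~ : ∀ {n m} {σ σ' : Fin n → Val m} → σ ~σ σ' → ∀ {E E'} → E ~P E' → subP σ E ~P subP σ' E'
  subP~ h hole~       = hole~
  subP~ h (appL~ e u) = appL~ (subP~ h e) (sub~ h u)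
  subP~ h (appR~ v e) = appR~ (subV~ h v) (subP~ h e)

[]~ : ∀ {t t' : Term 1} {v v'} → t ~ t' → v ~V v' → t [ v ] ~ t' [ v' ]
[]~ r q = sub~ (single~ q) r

cont~ : ∀ {n} {E E' : PCtx n} → E ~P E' → cont E ~V cont E'
cont~ e = lam~ (rst~ (plugP~ (renP~ suc e) (val~ (var~ zero))))

plugs-∘P : ∀ {n m} (ρ : Fin n → Fin m) (E E₁ : PCtx n) t →
  Plugs (renP ρ E) (plugP (renP ρ E₁) t) (plugP (renP ρ (E ∘P E₁)) t)
plugs-∘P ρ hole       E₁ t = p-hole
plugs-∘P ρ (appL E u) E₁ t = p-appL (plugs-∘P ρ E E₁ t)
plugs-∘P ρ (appR v E) E₁ t = p-appR (plugs-∘P ρ E E₁ t)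

-- A shift under a pending continuation captures the continuation together with
-- its argument context; on the other side it captures the composed context.
cont-appR-cont~ : ∀ {n} {E E' E₁ E₁' : PCtx n} → E ~P E' → E₁ ~P E₁' →
  cont (appR (cont E) E₁) ~V cont (E' ∘P E₁')
cont-appR-cont~ {E = E} {E'} {E₁} {E₁'} e e₁ =
  subst (λ z → lam (rst (app (val z) (plugP (renP suc E₁) (val (var zero))))) ~V cont (E' ∘P E₁'))
    (sym (renV-cont suc E))
    (lam~ (~cont (renP~ suc e) (plugP~ (renP~ suc e₁) (val~ (var~ zero)))
                 (plugs-∘P suc E' E₁' (val (var zero)))))

NonValue : ∀ {n} → Term n → Set
NonValue (val _) = ⊥
NonValue _       = ⊤

shiftRedex-~ˡ : ∀ {n} {a a' : Term n} {E u} → ShiftRedex a E u → a ~ a' →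
  Σ (PCtx n) λ E' → Σ (Term (suc n)) λ u' → ShiftRedex a' E' u' × E ~P E' × u ~ u'
shiftRedex-~ˡ sr-hole (sft~ r) = _ , _ , sr-hole , hole~ , r
shiftRedex-~ˡ (sr-appL sr) (app~ r q) with shiftRedex-~ˡ sr r
... | _ , _ , sr' , e , ur = _ , _ , sr-appL sr' , appL~ e q , ur
shiftRedex-~ˡ (sr-appR sr) (app~ (val~ v) q) with shiftRedex-~ˡ sr q
... | _ , _ , sr' , e , ur = _ , _ , sr-appR sr' , appR~ v e , ur

shiftRedex-~ʳ : ∀ {n} {a a' : Term n} {E' u'} → ShiftRedex a' E' u' → a ~ a' →
  Σ (PCtx n) λ E → Σ (Term (suc n)) λ u → ShiftRedex a E u × E ~P E' × u ~ u'
shiftRedex-~ʳ sr-hole (sft~ r) = _ , _ , sr-hole , hole~ , r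
shiftRedex-~ʳ (sr-appL sr) (app~ r q) with shiftRedex-~ʳ sr r
... | _ , _ , sr' , e , ur = _ , _ , sr-appL sr' , appL~ e q , ur
shiftRedex-~ʳ (sr-appR sr) (app~ (val~ v) q) with shiftRedex-~ʳ sr q
... | _ , _ , sr' , e , ur = _ , _ , sr-appR sr' , appR~ v e , ur

plugs-↦ : ∀ {E b s b₁} → Plugs E b s → b ↦ b₁ → Σ (Term 0) λ s₁ → s ↦ s₁ × Plugs E b₁ s₁
plugs-↦ p-hole d = _ , d , p-hole
plugs-↦ (p-appL p) d with plugs-↦ p d
... | _ , d' , p' = _ , ξ-appL d' , p-appL p'
plugs-↦ (p-appR p) d with plugs-↦ p d
... | _ , d' , p' = _ , ξ-appR _ d' , p-appR p'

plugs-↦* : ∀ {E b s b₁} → Plugs E b s → b ↦* b₁ → Σ (Term 0) λ s₁ → s ↦* s₁ × Plugs E b₁ s₁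
plugs-↦* p ε = _ , ε , p
plugs-↦* p (d ◅ ds) with plugs-↦ p d
... | _ , d' , p' with plugs-↦* p' ds
... | _ , ds' , p'' = _ , d' ◅ ds' , p''

plugs-nonValue : ∀ {n} {E : PCtx n} {b v} → Plugs E b (val v) → NonValue b → ⊥
plugs-nonValue p-hole ()

plugs-↦⁻¹ : ∀ {E b s s₁} → Plugs E b s → NonValue b → s ↦ s₁ →
  Σ (Term 0) λ b₁ → b ↦ b₁ × Plugs E b₁ s₁
plugs-↦⁻¹ p-hole     nv d = _ , d , p-hole
plugs-↦⁻¹ (p-appL p) nv (ξ-appL d) with plugs-↦⁻¹ p nv d
... | _ , d' , p' = _ , d' , p-appL p'
plugs-↦⁻¹ (p-appL p) nv (ξ-appR v d) = ⊥-elim (plugs-nonValue p nv)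
plugs-↦⁻¹ (p-appL p) nv (β t v)      = ⊥-elim (plugs-nonValue p nv)
plugs-↦⁻¹ (p-appR p) nv (ξ-appL ())
plugs-↦⁻¹ (p-appR p) nv (ξ-appR v d) with plugs-↦⁻¹ p nv d
... | _ , d' , p' = _ , d' , p-appR p'
plugs-↦⁻¹ (p-appR p) nv (β t w)      = ⊥-elim (plugs-nonValue p nv)

plugs-shiftRedex : ∀ {n} {E : PCtx n} {b s E₁ u} → Plugs E b s → ShiftRedex b E₁ u →
  ShiftRedex s (E ∘P E₁) u
plugs-shiftRedex p-hole     sr = sr
plugs-shiftRedex (p-appL p) sr = sr-appL (plugs-shiftRedex p sr)
plugs-shiftRedex (p-appR p) sr = sr-appR (plugs-shiftRedex p sr)

plugs-shiftRedex⁻¹ : ∀ {n} {E : PCtx n} {b s E₀ u} → Plugs E b s → NonValue b →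
  ShiftRedex s E₀ u → Σ (PCtx n) λ E₁ → ShiftRedex b E₁ u × E₀ ≡ E ∘P E₁
plugs-shiftRedex⁻¹ p-hole nv sr = _ , sr , refl
plugs-shiftRedex⁻¹ (p-appL p) nv (sr-appL sr) with plugs-shiftRedex⁻¹ p nv sr
... | _ , sr' , refl = _ , sr' , refl
plugs-shiftRedex⁻¹ (p-appL p) nv (sr-appR sr) = ⊥-elim (plugs-nonValue p nv)
plugs-shiftRedex⁻¹ (p-appR p) nv (sr-appL ())
plugs-shiftRedex⁻¹ (p-appR p) nv (sr-appR sr) with plugs-shiftRedex⁻¹ p nv sr
... | _ , sr' , refl = _ , sr' , refl

Simulated→ : Term 0 → Term 0 → Set
Simulated→ s₁ s' = Σ (Term 0) λ s₁' → s' ↦* s₁' × s₁ ~ s₁'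

Simulated← : Term 0 → Term 0 → Set
Simulated← s s₁' = Σ (Term 0) λ s₁ → s ↦* s₁ × s₁ ~ s₁'

apply-cont : ∀ {E : PCtx 0} {w} → rst (app (val (cont E)) (val w)) ↦ rst (rst (plugP E (val w)))
apply-cont {E} {w} =
  subst (λ z → rst (app (val (cont E)) (val w)) ↦ rst z) (cont-body-[] E w) (ξ-rst (β _ w))

mutual
  ~-forth : ∀ {s s' s₁ : Term 0} → s ~ s' → s ↦ s₁ → Simulated→ s₁ s'
  ~-forth (val~ _) ()
  ~-forth (sft~ _) ()
  ~-forth (app~ (val~ (lam~ r)) (val~ q)) (β t v) = _ , β _ _ ◅ ε , []~ r q
  ~-forth (app~ r q) (ξ-appL d) with ~-forth r d
  ... | _ , ds , r₁ = _ , gmap (λ x → app x _) ξ-appL ds , app~ r₁ q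
  ~-forth (app~ (val~ {v' = v'} vr) q) (ξ-appR _ d) with ~-forth q d
  ... | _ , ds , r₁ = _ , gmap (app (val v')) (ξ-appR v') ds , app~ (val~ vr) r₁
  ~-forth (rst~ r) (shift sr) with shiftRedex-~ˡ sr r
  ... | _ , _ , sr' , e , ur = _ , shift sr' ◅ ε , rst~ ([]~ ur (cont~ e))
  ~-forth (rst~ (val~ r)) (reset v) = _ , reset _ ◅ ε , val~ r
  ~-forth (rst~ r) (ξ-rst d) with ~-forth r d
  ... | _ , ds , r₁ = _ , gmap rst ξ-rst ds , rst~ r₁
  ~-forth (~cont e r p) d = ~cont-forth e r p d
  ~-forth (~rst² r) d = ~rst²-forth r d

  ~cont-forth : ∀ {E E' : PCtx 0} {b b' s' s₁} → E ~P E' → b ~ b' → Plugs E' b' s' →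
    rst (app (val (cont E)) b) ↦ s₁ → Simulated→ s₁ (rst s')
  ~cont-forth e r p (shift (sr-appL ()))
  ~cont-forth e r p (shift (sr-appR sr)) with shiftRedex-~ˡ sr r
  ... | _ , _ , sr' , e₁ , ur =
    _ , shift (plugs-shiftRedex p sr') ◅ ε , rst~ ([]~ ur (cont-appR-cont~ e e₁))
  ~cont-forth e r p (ξ-rst (ξ-appL ()))
  ~cont-forth e r p (ξ-rst (ξ-appR _ d)) with ~-forth r d
  ... | _ , ds , r₁ with plugs-↦* p ds
  ... | _ , ds' , p' = _ , gmap rst ξ-rst ds' , ~cont e r₁ p'
  ~cont-forth {E = E} {s' = s'} e (val~ q) p (ξ-rst (β _ w)) =
    _ , ε , subst (λ z → rst z ~ rst s') (sym (cont-body-[] E w)) (~rst² (plugs~ e (val~ q) p))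

  ~rst²-forth : ∀ {a a' s₁ : Term 0} → a ~ a' → rst (rst a) ↦ s₁ → Simulated→ s₁ (rst a')
  ~rst²-forth r (shift ())
  ~rst²-forth r (ξ-rst (shift sr)) with shiftRedex-~ˡ sr r
  ... | _ , _ , sr' , e , ur = _ , shift sr' ◅ ε , ~rst² ([]~ ur (cont~ e))
  ~rst²-forth (val~ r) (ξ-rst (reset v)) = _ , ε , rst~ (val~ r)
  ~rst²-forth r (ξ-rst (ξ-rst d)) with ~-forth r d
  ... | _ , ds , r₁ = _ , gmap rst ξ-rst ds , ~rst² r₁

mutual
  ~-back : ∀ {s s' s₁' : Term 0} → s ~ s' → s' ↦ s₁' → Simulated← s s₁'
  ~-back (val~ _) ()
  ~-back (sft~ _) ()
  ~-back (app~ (val~ (lam~ r)) (val~ q)) (β t v) = _ , β _ _ ◅ ε , []~ r q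
  ~-back (app~ r q) (ξ-appL d) with ~-back r d
  ... | _ , ds , r₁ = _ , gmap (λ x → app x _) ξ-appL ds , app~ r₁ q
  ~-back (app~ (val~ {v = v} vr) q) (ξ-appR _ d) with ~-back q d
  ... | _ , ds , r₁ = _ , gmap (app (val v)) (ξ-appR v) ds , app~ (val~ vr) r₁
  ~-back (rst~ r) (shift sr) with shiftRedex-~ʳ sr r
  ... | _ , _ , sr' , e , ur = _ , shift sr' ◅ ε , rst~ ([]~ ur (cont~ e))
  ~-back (rst~ (val~ r)) (reset v) = _ , reset _ ◅ ε , val~ r
  ~-back (rst~ r) (ξ-rst d) with ~-back r d
  ... | _ , ds , r₁ = _ , gmap rst ξ-rst ds , rst~ r₁
  ~-back (~rst² r) (shift sr) with shiftRedex-~ʳ sr r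
  ... | _ , _ , sr' , e , ur = _ , ξ-rst (shift sr') ◅ ε , ~rst² ([]~ ur (cont~ e))
  ~-back (~rst² (val~ r)) (reset v) = _ , ξ-rst (reset _) ◅ reset _ ◅ ε , val~ r
  ~-back (~rst² r) (ξ-rst d) with ~-back r d
  ... | _ , ds , r₁ = _ , gmap (λ x → rst (rst x)) (λ d → ξ-rst (ξ-rst d)) ds , ~rst² r₁
  ~-back (~cont e r p) d = ~cont-back e r p d

  ~cont-back : ∀ {E E' : PCtx 0} {b b' s' s₁'} → E ~P E' → b ~ b' → Plugs E' b' s' →
    rst s' ↦ s₁' → Simulated← (rst (app (val (cont E)) b)) s₁'
  ~cont-back e r@(val~ _)     p d = ~cont-value-back e r p d
  ~cont-back e r@(app~ _ _)   p d = ~cont-nonValue-back e r p tt d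
  ~cont-back e r@(sft~ _)     p d = ~cont-nonValue-back e r p tt d
  ~cont-back e r@(rst~ _)     p d = ~cont-nonValue-back e r p tt d
  ~cont-back e r@(~cont _ _ _) p d = ~cont-nonValue-back e r p tt d
  ~cont-back e r@(~rst² _)    p d = ~cont-nonValue-back e r p tt d

  -- The left side first applies the continuation to its value argument, and then
  -- simulates the right step under the extra reset.
  ~cont-value-back : ∀ {E E' : PCtx 0} {w w' s' s₁'} → E ~P E' → val w ~ val w' →
    Plugs E' (val w') s' → rst s' ↦ s₁' → Simulated← (rst (app (val (cont E)) (val w))) s₁'
  ~cont-value-back e q p (ξ-rst d) with plugP-back e q p d
  ... | _ , ds , r₁ = _ , apply-cont ◅ gmap (λ x → rst (rst x)) (λ d → ξ-rst (ξ-rst d)) ds , ~rst² r₁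
  ~cont-value-back hole~ q p-hole (reset _) = _ , apply-cont ◅ ξ-rst (reset _) ◅ reset _ ◅ ε , q
  ~cont-value-back e q p (shift sr) with shiftRedex-~ʳ sr (plugs~ e q p)
  ... | _ , _ , sr₀ , e₀ , ur = _ , apply-cont ◅ ξ-rst (shift sr₀) ◅ ε , ~rst² ([]~ ur (cont~ e₀))

  ~cont-nonValue-back : ∀ {E E' : PCtx 0} {b b' s' s₁'} → E ~P E' → b ~ b' → Plugs E' b' s' →
    NonValue b' → rst s' ↦ s₁' → Simulated← (rst (app (val (cont E)) b)) s₁'
  ~cont-nonValue-back {E = E} e r p nv (ξ-rst d) with plugs-↦⁻¹ p nv d
  ... | _ , db , p' with ~-back r db
  ... | _ , ds , r₁ = _ , gmap (λ x → rst (app (val (cont E)) x)) (λ d → ξ-rst (ξ-appR _ d)) ds ,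
                      ~cont e r₁ p'
  ~cont-nonValue-back e r p nv (reset _) = ⊥-elim (plugs-nonValue p nv)
  ~cont-nonValue-back e r p nv (shift sr) with plugs-shiftRedex⁻¹ p nv sr
  ... | _ , sr₁ , refl with shiftRedex-~ʳ sr₁ r
  ... | _ , _ , sr₀ , e₁ , ur = _ , shift (sr-appR sr₀) ◅ ε , rst~ ([]~ ur (cont-appR-cont~ e e₁))

  plugP-back : ∀ {E E' : PCtx 0} {b b' s' s₁'} → E ~P E' → b ~ b' → Plugs E' b' s' →
    s' ↦ s₁' → Simulated← (plugP E b) s₁'
  plugP-back hole~ r p-hole d = ~-back r d
  plugP-back (appL~ e u) r (p-appL p) (ξ-appL d) with plugP-back e r p d
  ... | _ , ds , r₁ = _ , gmap (λ x → app x _) ξ-appL ds , app~ r₁ u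
  plugP-back (appL~ hole~ u) (val~ {v = v} q) (p-appL p-hole) (ξ-appR _ d) with ~-back u d
  ... | _ , ds , r₁ = _ , gmap (app (val v)) (ξ-appR v) ds , app~ (val~ q) r₁
  plugP-back (appL~ hole~ (val~ q₂)) (val~ (lam~ r)) (p-appL p-hole) (β _ _) =
    _ , β _ _ ◅ ε , []~ r q₂
  plugP-back (appR~ v e) r (p-appR p) (ξ-appL ())
  plugP-back (appR~ {v = vl} v e) r (p-appR p) (ξ-appR _ d) with plugP-back e r p d
  ... | _ , ds , r₁ = _ , gmap (app (val vl)) (ξ-appR vl) ds , app~ (val~ v) r₁
  plugP-back (appR~ (lam~ r₀) hole~) (val~ q) (p-appR p-hole) (β _ _) = _ , β _ _ ◅ ε , []~ r₀ q

infix 4 _~E_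
data _~E_ : ECtx 0 → ECtx 0 → Set where
  hole~E : hole ~E hole
  appL~E : ∀ {F F' u u'} → F ~E F' → u ~ u' → appL F u ~E appL F' u'
  appR~E : ∀ {F F' v v'} → v ~V v' → F ~E F' → appR v F ~E appR v' F'
  rstC~E : ∀ {F F'} → F ~E F' → rstC F ~E rstC F'

plugE~ : ∀ {F F' t t'} → F ~E F' → t ~ t' → plugE F t ~ plugE F' t'
plugE~ hole~E       r = r
plugE~ (appL~E f u) r = app~ (plugE~ f r) u
plugE~ (appR~E v f) r = app~ (val~ v) (plugE~ f r)
plugE~ (rstC~E f)   r = rst~ (plugE~ f r)

_~Γ_ : VEnv → VEnv → Set
_~Γ_ = List.Pointwise _~V_

>>=⁺ : ∀ {A B C D : Set} {R : A → B → Set} {S : C → D → Set} {m m' f g} →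
  Maybe.Pointwise R m m' → (∀ {a b} → R a b → Maybe.Pointwise S (f a) (g b)) →
  Maybe.Pointwise S (m >>= f) (m' >>= g)
>>=⁺ nothing  k = nothing
>>=⁺ (just r) k = k r

justˡ-inv : ∀ {A B : Set} {R : A → B → Set} {m m' a} → Maybe.Pointwise R m m' →
  m ≡ just a → ∃ λ b → m' ≡ just b × R a b
justˡ-inv r refl = just-inv r

justʳ-inv : ∀ {A B : Set} {R : A → B → Set} {m m' b} → Maybe.Pointwise R m m' →
  m' ≡ just b → ∃ λ a → m ≡ just a × R a b
justʳ-inv (just r) refl = -, refl , r

nth⁺ : ∀ {Γ Γ'} → Γ ~Γ Γ' → ∀ i → Maybe.Pointwise _~V_ (nth Γ i) (nth Γ' i)
nth⁺ []       i       = nothing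
nth⁺ (r ∷ g)  zero    = just r
nth⁺ (r ∷ g)  (suc i) = nth⁺ g i

-- The context environment is empty, so every ■ⱼ fails to fill on both sides.
mutual
  fillC⁺ : ∀ {n Γ Γ'} → Γ ~Γ Γ' → (C : MC n) → Maybe.Pointwise _~_ (fillC [] Γ C) (fillC [] Γ' C)
  fillC⁺ g (mval V)   = >>=⁺ (fillV⁺ g V) (λ r → just (val~ r))
  fillC⁺ g (mapp C D) = >>=⁺ (fillC⁺ g C) (λ r → >>=⁺ (fillC⁺ g D) (λ q → just (app~ r q)))
  fillC⁺ g (mrst C)   = >>=⁺ (fillC⁺ g C) (λ r → just (rst~ r))
  fillC⁺ g (msft C)   = >>=⁺ (fillC⁺ g C) (λ r → just (sft~ r))
  fillC⁺ g (mbox j C) = nothing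

  fillV⁺ : ∀ {n Γ Γ'} → Γ ~Γ Γ' → (V : MV n) → Maybe.Pointwise _~V_ (fillV [] Γ V) (fillV [] Γ' V)
  fillV⁺ g (mvar x)  = just (var~ x)
  fillV⁺ g (mlam C)  = >>=⁺ (fillC⁺ g C) (λ r → just (lam~ r))
  fillV⁺ g (mhole i) = >>=⁺ (nth⁺ g i) (λ r → just (renV~ fromClosed r))

fillF⁺ : ∀ {Γ Γ'} → Γ ~Γ Γ' → (F : MF) → Maybe.Pointwise _~E_ (fillF [] Γ F) (fillF [] Γ' F)
fillF⁺ g fhole       = just hole~E
fillF⁺ g (fappL F C) = >>=⁺ (fillF⁺ g F) (λ r → >>=⁺ (fillC⁺ g C) (λ q → just (appL~E r q)))
fillF⁺ g (fappR V F) = >>=⁺ (fillV⁺ g V) (λ r → >>=⁺ (fillF⁺ g F) (λ q → just (appR~E r q)))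
fillF⁺ g (frst F)    = >>=⁺ (fillF⁺ g F) (λ r → just (rstC~E r))
fillF⁺ g (fbox j F)  = nothing

↦-pure : ∀ p {u} → ⌜ p ⌝ ↦ u → Σ PureT λ p' → u ≡ ⌜ p' ⌝
↦-pure (pval v) ()
↦-pure (prst a) (shift sr) = prst _ , refl
↦-pure (prst a) (reset v)  = pval v , refl
↦-pure (prst a) (ξ-rst d)  = prst _ , refl

↦*⇒=τ⇒ : ∀ {Γ} p {u} → ⌜ p ⌝ ↦* u → Σ PureT λ p' → u ≡ ⌜ p' ⌝ × pst [] Γ p =τ⇒ pst [] Γ p'
↦*⇒=τ⇒ p ε = p , refl , ε
↦*⇒=τ⇒ p (d ◅ ds) with ↦-pure p d
... | p₁ , refl with ↦*⇒=τ⇒ p₁ ds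
... | p₂ , eq , τs = p₂ , eq , step-τ (↦⇒⟶ d) ◅ τs

Sk-kt-body : Term 0 → Term 1
Sk-kt-body t = app (val (var zero)) (ren suc t)

data Candidate : State → State → Set where
  initial : ∀ t E → Candidate (pst [] [] (prst (plugP E (sft (Sk-kt-body t)))))
                              (pst [] [] (prst (plugP E t)))
  pure~   : ∀ {Γ Γ' p p'} → Γ ~Γ Γ' → ⌜ p ⌝ ~ ⌜ p' ⌝ → Candidate (pst [] Γ p) (pst [] Γ' p')
  env~    : ∀ {Γ Γ'} → Γ ~Γ Γ' → Candidate (est [] Γ) (est [] Γ')

after-initial-step~ : ∀ t E → rst (Sk-kt-body t [ cont E ]) ~ rst (plugP E t)
after-initial-step~ t E =
  subst (λ z → rst (app (val (cont E)) z) ~ rst (plugP E t)) (sym (ren-suc-[] t (cont E)))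
    (~cont (~P-refl E) (~-refl t) (plugs-plugP E t))

Candidate-forth : ∀ {s s' α s₁} → Candidate s s' → s —[ α ]→ s₁ →
  ∃ λ s₁' → s' =[ α ]⇒ s₁' × Candidate s₁ s₁'
Candidate-forth (initial t E) (step-τ st) =
  _ , ε , pure~ [] (subst (_~ rst (plugP E t))
                         (sym (rst-shiftRedex-↦ (shiftRedex-plugP E _) (⟶⇒↦ st)))
                         (after-initial-step~ t E))
Candidate-forth (pure~ {p' = p'} g r) (step-τ st) with ~-forth r (⟶⇒↦ st)
... | _ , ds , r₁ with ↦*⇒=τ⇒ p' ds
... | _ , refl , τs = _ , τs , pure~ g r₁
Candidate-forth (pure~ {p' = pval _} g (val~ q)) step-↓ =
  _ , (_ , _ , ε , step-↓ , ε) , env~ (++⁺ g (q ∷ []))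
Candidate-forth (pure~ {p' = prst _} g ()) step-↓
Candidate-forth (env~ g) (step-λ {i = i} {V = V} {F = F} e₁ e₂ e₃)
  with justˡ-inv (nth⁺ g i) e₁ | justˡ-inv (fillV⁺ g V) e₂ | justˡ-inv (fillF⁺ g F) e₃
... | _ , e₁' , lam~ tr | _ , e₂' , wr | _ , e₃' , rstC~E fr =
  _ , (_ , _ , ε , step-λ e₁' e₂' e₃' , ε) , pure~ g (rst~ (plugE~ fr ([]~ tr wr)))
Candidate-forth (env~ g) (step-□ () _ _)
Candidate-forth (env~ g) (step-pure () _)
Candidate-forth (env~ g) (step-split F E ())

Candidate-back : ∀ {s s' α s₁'} → Candidate s s' → s' —[ α ]→ s₁' →
  ∃ λ s₁ → s =[ α ]⇒ s₁ × Candidate s₁ s₁'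
Candidate-back (initial t E) (step-τ st) with ~-back (after-initial-step~ t E) (⟶⇒↦ st)
... | _ , ds , r₁ with ↦*⇒=τ⇒ (prst (plugP E (sft (Sk-kt-body t))))
                            (shift (shiftRedex-plugP E (Sk-kt-body t)) ◅ ds)
... | _ , refl , τs = _ , τs , pure~ [] r₁
Candidate-back (pure~ {p = p} g r) (step-τ st) with ~-back r (⟶⇒↦ st)
... | _ , ds , r₁ with ↦*⇒=τ⇒ p ds
... | _ , refl , τs = _ , τs , pure~ g r₁
Candidate-back (pure~ {p = pval _} g (val~ q)) step-↓ =
  _ , (_ , _ , ε , step-↓ , ε) , env~ (++⁺ g (q ∷ []))
Candidate-back (pure~ {p = prst _} g ()) step-↓
Candidate-back (env~ g) (step-λ {i = i} {V = V} {F = F} e₁ e₂ e₃)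
  with justʳ-inv (nth⁺ g i) e₁ | justʳ-inv (fillV⁺ g V) e₂ | justʳ-inv (fillF⁺ g F) e₃
... | _ , e₁' , lam~ tr | _ , e₂' , wr | _ , e₃' , rstC~E fr =
  _ , (_ , _ , ε , step-λ e₁' e₂' e₃' , ε) , pure~ g (rst~ (plugE~ fr ([]~ tr wr)))
Candidate-back (env~ g) (step-□ () _ _)
Candidate-back (env~ g) (step-pure () _)
Candidate-back (env~ g) (step-split F E ())

Candidate-isPureEnvBisim : IsPureEnvBisim Candidate
Candidate-isPureEnvBisim = record { forth = Candidate-forth ; back = Candidate-back }

proposition5p22 : (t : Term 0) (E : PCtx 0) →
    pst [] [] (prst (plugP E (sft (app (val (var zero)) (ren suc t)))))
      ≈ᵖ pst [] [] (prst (plugP E t))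
proposition5p22 t E = Candidate , Candidate-isPureEnvBisim , initial t E
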